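{- For any Quantified Discrete Duration Calculus (QDDC) formulas $A$ and $C$ and any horizon $H$, the following must-dominance relations hold: 1. $MPHOS_1(A,C) \leq_{dom}^C MPHOS_3(A,C) \leq_{dom}^C MPHOS_0(A,C)$; 2. $MPHOS_2(A,C) \leq_{dom}^C MPHOS_0(A,C)$.
   Context: QDDC (Quantified Discrete Duration Calculus) is an interval temporal logic over finite words with regular expressive power; a formula $D$ holds at a point of a behaviour iff the prefix up to that point satisfies $D$. Formulas are over propositions $I \cup O$ (inputs $I$, outputs $O$). A supervisor is a non-blocking output-nondeterministic Mealy machine over $(2^I,2^O)$; $L(S)$ is its set of input–output words $(ii,oo)$, and for an input sequence $ii$, $S[ii]=\{oo \mid (ii,oo)\in L(S)\}$. $S$ realizes invariance of $D$ if $L(S)\subseteq L(D)$. For supervisors $S_1,S_2$, $S_1\leq_{det}S_2$ iff $L(S_2)\subseteq L(S_1)$ ($S_2$ is a sub-supervisor of $S_1$). $MPS(D)$ is the maximally permissive supervisor realizing invariance of $D$. Given a supervisor $S$, a formula $D$ and horizon $H$, $MPHOS(S,D,H)$ is the maximally permissive sub-supervisor of $S$ that maximizes, from every state, the expected (over uniformly averaged input sequences of length $H$) minimum count of points in the next $H$ steps at which $D$ holds; $S\leq_{det}MPHOS(S,D,H)$. For a specification with hard requirement $D^h$ and soft requirement $D^s$, the synthesized supervisor is $MPHOS(MPS(D^h),D^s,H)$. Given an assumption–commitment pair $(A,C)$, four specification types are defined: Type0: hard $C$, soft $true$; Type1: hard $A\Rightarrow C$, soft $true$; Type2: hard $true$,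 soft $C$; Type3: hard $A\Rightarrow C$, soft $C$. $MPHOS_i(A,C)$ denotes the maximally permissive $H$-optimal supervisor obtained for the Type$i$ specification (assumed to exist, i.e. realizable). Must dominance: for supervisors $S_1,S_2$ and property $C$, $S_1\leq_{dom}^C S_2$ iff $MustInp(S_1,C)\subseteq MustInp(S_2,C)$, where $MustInp(S,C)=\{ii\in(2^I)^+ \mid \forall oo\in(2^O)^+.\ ((ii,oo)\in L(S)\Rightarrow (ii,oo)\models C)\}$. -}

module Defs where

open import Data.Bool using (Bool; true; false; _∧_; _∨_; not; if_then_else_)
open import Data.Nat using (ℕ; zero; suc; _+_; _∸_; _≤_; _≤ᵇ_; _<ᵇ_; _≡ᵇ_; _⊓_)
open import Data.Fin using (Fin)
open import Data.Bool.ListAction using (any; all)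
open import Data.Nat.ListAction using (sum)
open import Data.Vec using (Vec; []; _∷_; lookup)
open import Data.List using (List; []; _∷_; length; map; concatMap; zip; take; upTo; applyUpTo; filterᵇ; _++_)
open import Data.Maybe using (Maybe; just; nothing; maybe; is-just)
open import Data.Product using (_×_; _,_; proj₁; proj₂; ∃)
open import Data.Sum using (_⊎_; inj₁; inj₂)
open import Relation.Binary.PropositionalEquality using (_≡_)
open import Relation.Nullary using (¬_)

data Prop (V : Set) : Set where
  pvar : V → Prop V
  ptt  : Prop V
  pnot : Prop V → Prop V
  pand : Prop V → Prop V → Prop V

data Form (V : Set) : Set where
  point  : Prop V → Form V            -- ⟨P⟩    : b = e and P at b
  every  : Prop V → Form V            -- ⌈⌈P⌉⌉  : P at all points b..e
  everyx : Prop V → Form V            -- ⌈P⌉    : b < e and P at all points b..e-1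
  chop   : Form V → Form V → Form V
  neg    : Form V → Form V
  conj   : Form V → Form V → Form V
  ex     : Form (Maybe V) → Form V    -- ∃p. D  (p = nothing)
  lenLe  : ℕ → Form V                 -- slen ≤ c   (slen = e - b)
  cntLe  : Prop V → ℕ → Form V        -- scount P ≤ c  (points in [b,e) where P holds)

evalP : {V : Set} → (V → Bool) → Prop V → Bool
evalP σ (pvar v)   = σ v
evalP σ ptt        = true
evalP σ (pnot P)   = not (evalP σ P)
evalP σ (pand P Q) = evalP σ P ∧ evalP σ Q

range : ℕ → ℕ → List ℕ
range b k = applyUpTo (b +_) k

at : List Bool → ℕ → Bool
at []       _       = false
at (x ∷ xs) zero    = x
at (x ∷ xs) (suc j) = at xs j

boolLists : ℕ → List (List Bool)
boolLists zero    = [] ∷ []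
boolLists (suc n) = concatMap (λ l → (false ∷ l) ∷ (true ∷ l) ∷ []) (boolLists n)

extend : {V : Set} → (ℕ → V → Bool) → List Bool → ℕ → Maybe V → Bool
extend ρ bs j nothing  = at bs j
extend ρ bs j (just v) = ρ j v

-- eval N ρ b e D : D holds in the interval [b,e] of the behaviour ρ
-- whose points are 0..N.
eval : {V : Set} → ℕ → (ℕ → V → Bool) → ℕ → ℕ → Form V → Bool
eval N ρ b e (point P)   = (b ≡ᵇ e) ∧ evalP (ρ b) P
eval N ρ b e (every P)   = all (λ j → evalP (ρ j) P) (range b (suc (e ∸ b)))
eval N ρ b e (everyx P)  = (b <ᵇ e) ∧ all (λ j → evalP (ρ j) P) (range b (e ∸ b))
eval N ρ b e (chop D E)  = any (λ m → eval N ρ b m D ∧ eval N ρ m e E) (range b (suc (e ∸ b)))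
eval N ρ b e (neg D)     = not (eval N ρ b e D)
eval N ρ b e (conj D E)  = eval N ρ b e D ∧ eval N ρ b e E
eval N ρ b e (ex D)      = any (λ bs → eval N (extend ρ bs) b e D) (boolLists (suc N))
eval N ρ b e (lenLe c)   = (e ∸ b) ≤ᵇ c
eval N ρ b e (cntLe P c) =
  sum (map (λ j → if evalP (ρ j) P then 1 else 0) (range b (e ∸ b))) ≤ᵇ c

In : ℕ → Set
In nI = Vec Bool nI          -- 2^I  (I = {0..nI-1})

Out : ℕ → Set
Out nO = Vec Bool nO

Var : ℕ → ℕ → Set
Var nI nO = Fin nI ⊎ Fin nO

QDDC : ℕ → ℕ → Set
QDDC nI nO = Form (Var nI nO)

ttF : ∀ {nI nO} → QDDC nI nO
ttF = every ptt

_⇒F_ : ∀ {nI nO} → QDDC nI nO → QDDC nI nO → QDDC nI nO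
A ⇒F C = neg (conj A (neg C))

Word : ℕ → ℕ → Set
Word nI nO = List (In nI × Out nO)

letterVal : ∀ {nI nO} → In nI × Out nO → Var nI nO → Bool
letterVal (i , o) (inj₁ x) = lookup i x
letterVal (i , o) (inj₂ y) = lookup o y

valAt : ∀ {nI nO} → Word nI nO → ℕ → Var nI nO → Bool
valAt []       _       v = false
valAt (x ∷ w)  zero    v = letterVal x v
valAt (x ∷ w)  (suc j) v = valAt w j v

-- a (nonempty) word satisfies D iff D holds on its full interval [0, |w|-1]
satB : ∀ {nI nO} → Word nI nO → QDDC nI nO → Bool
satB []      D = false
satB (x ∷ w) D = eval (length w) (valAt (x ∷ w)) 0 (length w) D

Sat : ∀ {nI nO} → List (In nI) → List (Out nO) → QDDC nI nO → Set
Sat ii oo D = satB (zip ii oo) D ≡ true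

-- Supervisors: non-blocking output-nondeterministic Mealy machines

record Supervisor (nI nO : ℕ) : Set where
  field
    nQ          : ℕ
    q₀          : Fin nQ
    δ           : Fin nQ → In nI → Out nO → Maybe (Fin nQ)
    nonblocking : ∀ q i → ∃ λ o → is-just (δ q i o) ≡ true

open Supervisor public

runFrom : ∀ {nI nO} (S : Supervisor nI nO) → Fin (nQ S) → Word nI nO → Maybe (Fin (nQ S))
runFrom S q []            = just q
runFrom S q ((i , o) ∷ w) = maybe (λ q' → runFrom S q' w) nothing (δ S q i o)

accepts : ∀ {nI nO} → Supervisor nI nO → Word nI nO → Bool
accepts S w = is-just (runFrom S (q₀ S) w)

InL⁰ : ∀ {nI nO} → Supervisor nI nO → List (In nI) → List (Out nO) → Set
InL⁰ S ii oo = (length ii ≡ length oo) × (accepts S (zip ii oo) ≡ true)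

InL : ∀ {nI nO} → Supervisor nI nO → List (In nI) → List (Out nO) → Set
InL S ii oo = (¬ ii ≡ []) × InL⁰ S ii oo

_≤det_ : ∀ {nI nO} → Supervisor nI nO → Supervisor nI nO → Set
S₁ ≤det S₂ = ∀ ii oo → InL S₂ ii oo → InL S₁ ii oo

Realizes : ∀ {nI nO} → Supervisor nI nO → QDDC nI nO → Set
Realizes S D = ∀ ii oo → InL S ii oo → Sat ii oo D

IsMPS : ∀ {nI nO} → QDDC nI nO → Supervisor nI nO → Set
IsMPS D S = Realizes S D × (∀ S' → Realizes S' D → S ≤det S')

allVecs : (n : ℕ) → List (Vec Bool n)
allVecs zero    = [] ∷ []
allVecs (suc n) = concatMap (λ v → (false ∷ v) ∷ (true ∷ v) ∷ []) (allVecs n)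

seqs : {A : Set} → List A → ℕ → List (List A)
seqs xs zero    = [] ∷ []
seqs xs (suc n) = concatMap (λ x → map (x ∷_) (seqs xs n)) xs

-- minimum of a list (0 on the empty list; never used on empty lists
-- for reachable histories, by non-blocking)
minimumℕ : List ℕ → ℕ
minimumℕ []       = 0
minimumℕ (x ∷ []) = x
minimumℕ (x ∷ y ∷ xs) = x ⊓ minimumℕ (y ∷ xs)

-- number of points k, k+1, ..., k+H-1 of w at which D holds
-- (D holds at point j iff the prefix w[0..j] satisfies D)
countD : ∀ {nI nO} → QDDC nI nO → Word nI nO → ℕ → ℕ → ℕ
countD D w k H = sum (map (λ j → if satB (take (suc (k + j)) w) D then 1 else 0) (upTo H))

-- Sum over all input sequences ii' of length H of the minimum, over all
-- output sequences oo' allowed by S after history (ii, oo), of the number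
-- of points in the next H steps at which D holds.
-- (= |2^I|^H times the expected value under the uniform distribution)
value : ∀ {nI nO} → Supervisor nI nO → QDDC nI nO → ℕ → List (In nI) → List (Out nO) → ℕ
value {nI} {nO} S D H ii oo =
  sum (map (λ ii' →
        minimumℕ (map (λ oo' → countD D (zip (ii ++ ii') (oo ++ oo')) (length ii) H)
                      (filterᵇ (λ oo' → accepts S (zip (ii ++ ii') (oo ++ oo')))
                               (seqs (allVecs nO) H))))
      (seqs (allVecs nI) H))

IsHOptimal : ∀ {nI nO} → Supervisor nI nO → QDDC nI nO → ℕ → Supervisor nI nO → Set
IsHOptimal S D H S' =
  (S ≤det S') ×
  (∀ S'' → S ≤det S'' → ∀ ii oo → InL⁰ S' ii oo → InL⁰ S'' ii oo →
     value S'' D H ii oo ≤ value S' D H ii oo)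

IsMPHOS : ∀ {nI nO} → Supervisor nI nO → QDDC nI nO → ℕ → Supervisor nI nO → Set
IsMPHOS S D H S' = IsHOptimal S D H S' × (∀ S'' → IsHOptimal S D H S'' → S' ≤det S'')

MustInp : ∀ {nI nO} → Supervisor nI nO → QDDC nI nO → List (In nI) → Set
MustInp {nI} {nO} S C ii = (¬ ii ≡ []) × (∀ (oo : List (Out nO)) → InL S ii oo → Sat ii oo C)

_≤dom[_]_ : ∀ {nI nO} → Supervisor nI nO → QDDC nI nO → Supervisor nI nO → Set
S₁ ≤dom[ C ] S₂ = ∀ ii → MustInp S₁ C ii → MustInp S₂ C ii

module Submission where

-- Must dominance is antitone in the language: if L(S₂) ⊆ L(S₁),
-- every input on which all runs of S₁ satisfy C is also one for S₂; and a
-- supervisor realizing invariance of C dominates every supervisor.  So: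
--   * S₀, a sub-supervisor of M₀ = MPS(C), realizes C, hence S₀ dominates S₁, S₂ and S₃;
--   * L(S₃) ⊆ L(M₃) ⊆ L(M₁) ⊆ L(S₁): the first inclusion holds as S₃ is a
--     sub-supervisor of M₃, the second as M₁ and M₃ are both MPS(A ⇒ C), and
--     the last because the soft requirement true is met at every point of
--     every nonempty run, so M₁ is itself H-optimal for true and the maximally
--     permissive such sub-supervisor S₁ keeps all of L(M₁).

open import Defs
open import Data.Nat using (ℕ; zero; suc; _+_; _≤_; z≤n)
open import Data.Nat.Properties using (≤-refl; ≤-trans; m⊓n≤m; ⊓-glb; +-mono-≤)
open import Data.Product using (_×_; _,_; proj₁; proj₂)
open import Data.Bool using (Bool; true; false; if_then_else_; T?)
open import Data.List using (List; []; _∷_; length; map; zip; take; upTo; filterᵇ; _++_)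
open import Data.List.Properties using (length-++; length-applyUpTo)
open import Data.List.Relation.Unary.All using (All; []; _∷_)
import Data.List.Relation.Unary.All as All
open import Data.List.Relation.Unary.All.Properties using (map⁺; concat⁺; filter⁺)
open import Data.Nat.ListAction using (sum)
open import Data.Bool.ListAction using (all)
open import Relation.Binary.PropositionalEquality using (_≡_; _≢_; refl; sym; trans; cong; cong₂; subst)
open import Data.Empty using (⊥-elim)

private
  variable
    A : Set
    nI nO : ℕ

seqs-length : (xs : List A) (n : ℕ) → All (λ s → length s ≡ n) (seqs xs n)
seqs-length xs zero    = refl ∷ []
seqs-length xs (suc n) =
  concat⁺ (map⁺ (All.universal (λ x → map⁺ (All.map (cong suc) (seqs-length xs n))) xs))

filterᵇ-nonempty : {P : A → Set} (p q : A → Bool) (xs : List A) → All P xs →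
  (∀ x → P x → p x ≡ true → q x ≡ true) → filterᵇ p xs ≢ [] → filterᵇ q xs ≢ []
filterᵇ-nonempty p q []       []         p⇒q ne = ne
filterᵇ-nonempty p q (x ∷ xs) (px ∷ pxs) p⇒q ne with p x in px≡ | q x in qx≡
... | _     | true  = λ ()
... | true  | false with () ← trans (sym qx≡) (p⇒q x px px≡)
... | false | false = filterᵇ-nonempty p q xs pxs p⇒q ne

minimum-≤-head : (x : ℕ) (xs : List ℕ) → minimumℕ (x ∷ xs) ≤ x
minimum-≤-head x []       = ≤-refl
minimum-≤-head x (y ∷ xs) = m⊓n≤m x _

≤-minimum-map : (f : A → ℕ) (H : ℕ) (ys : List A) → ys ≢ [] →
  All (λ y → H ≤ f y) ys → H ≤ minimumℕ (map f ys)
≤-minimum-map f H []            ne _              = ⊥-elim (ne refl)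
≤-minimum-map f H (y ∷ [])      _  (H≤fy ∷ _)     = H≤fy
≤-minimum-map f H (y ∷ y′ ∷ ys) _  (H≤fy ∷ H≤fys) = ⊓-glb H≤fy (≤-minimum-map f H (y′ ∷ ys) (λ ()) H≤fys)

minimum-map-mono : (f : A → ℕ) (H : ℕ) (xs ys : List A) → (∀ x → f x ≤ H) →
  All (λ y → H ≤ f y) ys → (xs ≢ [] → ys ≢ []) → minimumℕ (map f xs) ≤ minimumℕ (map f ys)
minimum-map-mono f H []       ys f≤H H≤f ne = z≤n
minimum-map-mono f H (x ∷ xs) ys f≤H H≤f ne =
  ≤-trans (minimum-≤-head (f x) (map f xs))
          (≤-trans (f≤H x) (≤-minimum-map f H ys (ne (λ ())) H≤f))

indicator : Bool → ℕ
indicator b = if b then 1 else 0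

sum-indicator-≤ : (p : A → Bool) (xs : List A) → sum (map (λ x → indicator (p x)) xs) ≤ length xs
sum-indicator-≤ p []       = z≤n
sum-indicator-≤ p (x ∷ xs) = +-mono-≤ (indicator≤1 (p x)) (sum-indicator-≤ p xs)
  where
  indicator≤1 : ∀ b → indicator b ≤ 1
  indicator≤1 true  = ≤-refl
  indicator≤1 false = z≤n

sum-indicator-all : (p : A → Bool) (xs : List A) → (∀ x → p x ≡ true) →
  sum (map (λ x → indicator (p x)) xs) ≡ length xs
sum-indicator-all p []       all-p = refl
sum-indicator-all p (x ∷ xs) all-p = cong₂ _+_ (cong indicator (all-p x)) (sum-indicator-all p xs all-p)

sum-mono : {P : A → Set} (f g : A → ℕ) (xs : List A) → All P xs →
  (∀ x → P x → f x ≤ g x) → sum (map f xs) ≤ sum (map g xs)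
sum-mono f g []       []         f≤g = z≤n
sum-mono f g (x ∷ xs) (px ∷ pxs) f≤g = +-mono-≤ (f≤g x px) (sum-mono f g xs pxs f≤g)

countD-≤ : (D : QDDC nI nO) (w : Word nI nO) (k H : ℕ) → countD D w k H ≤ H
countD-≤ D w k H =
  subst (countD D w k H ≤_) (length-applyUpTo (λ j → j) H) (sum-indicator-≤ _ (upTo H))

ttF-holds : (x : In nI × Out nO) (w : Word nI nO) → satB (x ∷ w) ttF ≡ true
ttF-holds x w = all-const-true (upTo (suc (length w)))
  where
  all-const-true : (xs : List ℕ) → all (λ _ → true) xs ≡ true
  all-const-true []       = refl
  all-const-true (_ ∷ xs) = all-const-true xs

countD-ttF : (xs : List (In nI)) (ys : List (Out nO)) (k H : ℕ) →
  xs ≢ [] → ys ≢ [] → countD ttF (zip xs ys) k H ≡ H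
countD-ttF []       _        k H ne _  = ⊥-elim (ne refl)
countD-ttF (_ ∷ _)  []       k H _  ne = ⊥-elim (ne refl)
countD-ttF (x ∷ xs) (y ∷ ys) k H _  _  =
  trans (sum-indicator-all _ (upTo H) (λ j → ttF-holds (x , y) (take (k + j) (zip xs ys)))) (length-applyUpTo (λ j → j) H)

++-nonempty : (xs ys : List A) {n : ℕ} → length ys ≡ suc n → xs ++ ys ≢ []
++-nonempty (_ ∷ _) ys len ()
++-nonempty []      (_ ∷ _) len ()

countD-ttF-extension : (ii ii′ : List (In nI)) (oo oo′ : List (Out nO)) (H : ℕ) →
  length ii′ ≡ H → length oo′ ≡ H → H ≤ countD ttF (zip (ii ++ ii′) (oo ++ oo′)) (length ii) H
countD-ttF-extension ii ii′ oo oo′ zero    _    _    = z≤n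
countD-ttF-extension ii ii′ oo oo′ (suc H) li′ lo′ =
  subst (suc H ≤_) (sym (countD-ttF _ _ (length ii) (suc H) (++-nonempty ii ii′ li′) (++-nonempty oo oo′ lo′)))
        ≤-refl

continuations : Supervisor nI nO → ℕ → List (In nI) → List (Out nO) → List (In nI) → List (List (Out nO))
continuations {nO = nO} S H ii oo ii′ =
  filterᵇ (λ oo′ → accepts S (zip (ii ++ ii′) (oo ++ oo′))) (seqs (allVecs nO) H)

guaranteed : Supervisor nI nO → QDDC nI nO → ℕ → List (In nI) → List (Out nO) → List (In nI) → ℕ
guaranteed S D H ii oo ii′ =
  minimumℕ (map (λ oo′ → countD D (zip (ii ++ ii′) (oo ++ oo′)) (length ii) H) (continuations S H ii oo ii′))

≤det-trans : {S₁ S₂ S₃ : Supervisor nI nO} → S₁ ≤det S₂ → S₂ ≤det S₃ → S₁ ≤det S₃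
≤det-trans S₁≤S₂ S₂≤S₃ ii oo run = S₁≤S₂ ii oo (S₂≤S₃ ii oo run)

-- Language inclusion also covers the empty run, which every supervisor has.
≤det-InL⁰ : {S₁ S₂ : Supervisor nI nO} → S₁ ≤det S₂ → ∀ ii oo → InL⁰ S₂ ii oo → InL⁰ S₁ ii oo
≤det-InL⁰ S₁≤S₂ []      oo (len , _) = len , refl
≤det-InL⁰ S₁≤S₂ (i ∷ ii) oo run      = proj₂ (S₁≤S₂ (i ∷ ii) oo ((λ ()) , run))

-- For the soft requirement true, a sub-supervisor can never guarantee more
-- than the supervisor it refines: the latter guarantees the maximum H
-- whenever the former allows any continuation at all.
guaranteed-ttF-mono : {M S : Supervisor nI nO} (H : ℕ) → M ≤det S →
  ∀ ii oo ii′ → length ii ≡ length oo → length ii′ ≡ H →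
  guaranteed S ttF H ii oo ii′ ≤ guaranteed M ttF H ii oo ii′
guaranteed-ttF-mono {nI} {nO} {M} {S} H M≤S ii oo ii′ len li′ =
  minimum-map-mono count H (continuations S H ii oo ii′) (continuations M H ii oo ii′)
    (λ oo′ → countD-≤ ttF (zip (ii ++ ii′) (oo ++ oo′)) (length ii) H)
    (All.map (λ {oo′} lo′ → countD-ttF-extension ii ii′ oo oo′ H li′ lo′)
             (filter⁺ (λ oo′ → T? (accepts-on M oo′)) (seqs-length (allVecs nO) H)))
    (filterᵇ-nonempty (accepts-on S) (accepts-on M) (seqs (allVecs nO) H) (seqs-length (allVecs nO) H)
       (λ oo′ lo′ acc → proj₂ (≤det-InL⁰ M≤S (ii ++ ii′) (oo ++ oo′) (same-length oo′ lo′ , acc))))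
  where
  count : List (Out nO) → ℕ
  count oo′ = countD ttF (zip (ii ++ ii′) (oo ++ oo′)) (length ii) H
  accepts-on : Supervisor nI nO → List (Out nO) → Bool
  accepts-on S′ oo′ = accepts S′ (zip (ii ++ ii′) (oo ++ oo′))
  same-length : ∀ oo′ → length oo′ ≡ H → length (ii ++ ii′) ≡ length (oo ++ oo′)
  same-length oo′ lo′ =
    trans (length-++ ii) (trans (cong₂ _+_ len (trans li′ (sym lo′))) (sym (length-++ oo)))

ttF-optimal : (M : Supervisor nI nO) (H : ℕ) → IsHOptimal M ttF H M
ttF-optimal {nI = nI} M H = (λ _ _ run → run) , λ S M≤S ii oo M-run _ →
  sum-mono (guaranteed S ttF H ii oo) (guaranteed M ttF H ii oo) (seqs (allVecs nI) H)
    (seqs-length (allVecs nI) H)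
    (λ ii′ li′ → guaranteed-ttF-mono H M≤S ii oo ii′ (proj₁ M-run) li′)

mphos-ttF-keeps-all : {M S : Supervisor nI nO} (H : ℕ) → IsMPHOS M ttF H S → S ≤det M
mphos-ttF-keeps-all {M = M} H mphos = proj₂ mphos M (ttF-optimal M H)

mphos-refines : {M S : Supervisor nI nO} (D : QDDC nI nO) (H : ℕ) → IsMPHOS M D H S → M ≤det S
mphos-refines D H mphos = proj₁ (proj₁ mphos)

realizes-sub : {S₁ S₂ : Supervisor nI nO} {D : QDDC nI nO} → S₁ ≤det S₂ → Realizes S₁ D → Realizes S₂ D
realizes-sub S₁≤S₂ real ii oo run = real ii oo (S₁≤S₂ ii oo run)

≤det⇒≤dom : {S₁ S₂ : Supervisor nI nO} {C : QDDC nI nO} → S₁ ≤det S₂ → S₁ ≤dom[ C ] S₂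
≤det⇒≤dom S₁≤S₂ ii (ne , must) = ne , λ oo run → must oo (S₁≤S₂ ii oo run)

realizes⇒≤dom : {S₁ S₂ : Supervisor nI nO} {C : QDDC nI nO} → Realizes S₂ C → S₁ ≤dom[ C ] S₂
realizes⇒≤dom real ii (ne , _) = ne , λ oo run → real ii oo run

lemma2 : ∀ {nI nO : ℕ} (A C : QDDC nI nO) (H : ℕ)
           (M₀ M₁ M₂ M₃ S₀ S₁ S₂ S₃ : Supervisor nI nO) →
           IsMPS C M₀ → IsMPHOS M₀ ttF H S₀ →
           IsMPS (A ⇒F C) M₁ → IsMPHOS M₁ ttF H S₁ →
           IsMPS ttF M₂ → IsMPHOS M₂ C H S₂ →
           IsMPS (A ⇒F C) M₃ → IsMPHOS M₃ C H S₃ →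
           ((S₁ ≤dom[ C ] S₃) × (S₃ ≤dom[ C ] S₀)) × (S₂ ≤dom[ C ] S₀)
lemma2 {nI} {nO} A C H M₀ M₁ M₂ M₃ S₀ S₁ S₂ S₃ mps₀ mphos₀ mps₁ mphos₁ _ _ mps₃ mphos₃ =
  (≤det⇒≤dom S₁≤S₃ , S₀-dominates) , S₀-dominates
  where
  S₁≤S₃ : S₁ ≤det S₃
  S₁≤S₃ = ≤det-trans (mphos-ttF-keeps-all H mphos₁)
            (≤det-trans (proj₂ mps₁ M₃ (proj₁ mps₃)) (mphos-refines C H mphos₃))
  -- S₀ refines M₀ = MPS(C), so it realizes C
  S₀-dominates : {S : Supervisor nI nO} → S ≤dom[ C ] S₀
  S₀-dominates = realizes⇒≤dom (realizes-sub (mphos-refines ttF H mphos₀) (proj₁ mps₀))
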